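{- Let $G=(V,E)$ be a DAG with topological order $v_1,\ldots,v_{|V|}$, let $i\in\{1,\ldots,|V|\}$, and for $t\in\{0,\ldots,|V|\}$ let $S_t$ be the support of $G_t=G[\{v_1,\ldots,v_t\}]$. Then reachability among the vertices of $S_{i-1}\cup\{v_i\}$ is determined by knowing, for every $j\in\{1,\ldots,i\}$, which vertices of $S_{j-1}$ reach $v_j$: namely, for all $v_s,v_t\in S_{i-1}\cup\{v_i\}$, $v_s$ reaches $v_t$ if and only if either $s=t$, or $s<t$, $v_s\in S_{t-1}$ and $v_s$ reaches $v_t$; and whenever $s<t$ one has $v_s\in S_{t-1}$.
   Context: A topological order is an ordering of the vertices such that every edge goes from an earlier to a later vertex; $G_0$ is the empty graph. In a directed graph $H$, $u$ reaches $v$ if there is a path (sequence of distinct vertices, consecutive ones joined by edges of $H$, at least one vertex) from $u$ to $v$ in $H$. An antichain of $H$ is a set of vertices no one of which reaches a different one in $H$. A set $A$ reaches $v$ if some $u\in A$ reaches $v$. For antichains $A,B$ of $H$ of the same size, $B$ dominates $A$ (in $H$) if for every $b\in B$, $A$ reaches $b$ in $H$; antichains of different sizes are not related. An $H$-frontier antichain is an antichain of $H$ not dominated in $H$ by any other antichain of $H$. The support $S_t$ of $G_t$ is the union of all $G_t$-frontier antichains. -}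

module Defs where

open import Data.Nat using (ℕ) renaming (_<_ to _<ℕ_)
open import Data.Fin using (Fin; toℕ; _<_)
open import Data.Fin.Subset using (Subset; _∈_; ∣_∣)
open import Data.Bool using (Bool; true)
open import Data.List using (List; []; _∷_; [_])
open import Data.List.Relation.Unary.Unique.Propositional using (Unique)
open import Data.Product using (Σ; ∃; _×_)
open import Data.Unit using (⊤)
open import Relation.Binary.PropositionalEquality using (_≡_; _≢_)
open import Relation.Nullary using (¬_)

Graph : ℕ → Set
Graph n = Fin n → Fin n → Bool

Edge : ∀ {n} → Graph n → Fin n → Fin n → Set
Edge G u v = G u v ≡ true

-- The vertex order 0,1,…,n-1 is a topological order of G
-- (vertex v_k of the paper is the Fin index k-1).  This makes G a DAG.
IsTopOrder : ∀ {n} → Graph n → Set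
IsTopOrder G = ∀ u v → Edge G u v → u < v

-- Walks inside the induced subgraph on the vertex set  P,
-- recording the list of visited vertices.
data WalkIn {n} (G : Graph n) (P : Fin n → Set) : Fin n → Fin n → List (Fin n) → Set where
  single : ∀ {u} → P u → WalkIn G P u u [ u ]
  step   : ∀ {u w v xs} → P u → Edge G u w → WalkIn G P w v xs → WalkIn G P u v (u ∷ xs)

Reaches : ∀ {n} → Graph n → (Fin n → Set) → Fin n → Fin n → Set
Reaches G P u v = ∃ λ xs → WalkIn G P u v xs × Unique xs

-- Vertex set of G_t = G[{v_1,…,v_t}]  (Fin indices 0,…,t-1).
Prefix : ∀ {n} → ℕ → Fin n → Set
Prefix t v = toℕ v <ℕ t

All : ∀ {n} → Fin n → Set
All _ = ⊤

IsAntichain : ∀ {n} → Graph n → (Fin n → Set) → Subset n → Set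
IsAntichain G P A =
  (∀ u → u ∈ A → P u) ×
  (∀ u v → u ∈ A → v ∈ A → u ≢ v → ¬ Reaches G P u v)

SetReaches : ∀ {n} → Graph n → (Fin n → Set) → Subset n → Fin n → Set
SetReaches G P A v = Σ _ λ u → u ∈ A × Reaches G P u v

Dominates : ∀ {n} → Graph n → (Fin n → Set) → Subset n → Subset n → Set
Dominates G P B A = ∣ A ∣ ≡ ∣ B ∣ × (∀ b → b ∈ B → SetReaches G P A b)

IsFrontier : ∀ {n} → Graph n → (Fin n → Set) → Subset n → Set
IsFrontier G P A =
  IsAntichain G P A ×
  (∀ B → IsAntichain G P B → B ≢ A → ¬ Dominates G P B A)

InSupport : ∀ {n} → Graph n → ℕ → Fin n → Set
InSupport G t v = Σ (Subset _) λ A → IsFrontier G (Prefix t) A × v ∈ A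

{-# OPTIONS --safe #-}

-- Reachability from s to t along a topological order only uses vertices of
-- index at most t, so the whole content is the second claim: a vertex v_s of
-- S_{i-1} stays in S_{t-1} for every s < t ≤ i.  It suffices to go down one
-- step, from S_k to S_{k-1}.  Let A be a G_k-frontier antichain through v_s.
-- If v_k ∉ A, then A is already G_{k-1}-frontier; otherwise A - v_k is, since
-- an antichain B dominating A - v_k in G_{k-1} would make B ∪ {v_k} an
-- antichain dominating A in G_k (v_k is a sink of G_k, and no element of B
-- reaches v_k, for else so would an element of A - v_k).

module Submission where

open import Defs
open import Data.Nat using (ℕ; suc; _≤′_; ≤′-refl; ≤′-step) renaming (_<_ to _<ℕ_; _≤_ to _≤ℕ_)
import Data.Nat.Properties as ℕ
open import Data.Fin using (Fin; toℕ; _<_; _≤_; _≟_)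
open import Data.Fin.Properties using (any?; toℕ-injective)
open import Data.Fin.Subset using (Subset; _∈_; _∉_; _⊆_; ∣_∣; _-_; _∪_; ⁅_⁆; ⊥; inside; outside)
open import Data.Fin.Subset.Properties
  using (_∈?_; p─q⊆p; p─⊥≡p; ∪-identityʳ; x∈p∧x≢y⇒x∈p-y; x∈p∪q⁺; x∈p∪q⁻; x∈⁅x⁆; x∈⁅y⁆⇒x≡y)
open import Data.Vec using (_∷_; here; there)
open import Data.List.Relation.Unary.All as ListAll using ([]; _∷_)
open import Data.List.Relation.Unary.AllPairs using ([]; _∷_)
open import Data.List.Relation.Unary.Unique.Propositional using (Unique)
open import Data.Product using (_×_; _,_; ∃)
open import Data.Sum using (_⊎_; inj₁; inj₂)
open import Data.Unit using (tt)
open import Function using (_∘_)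
open import Function.Bundles using (_⇔_; mk⇔)
open import Relation.Binary.PropositionalEquality using (_≡_; _≢_; refl; sym; trans; cong; subst; module ≡-Reasoning)
open import Relation.Nullary using (¬_; yes; no; contradiction)
open import Relation.Nullary.Decidable using (_×-dec_)

x∈p⇒∣p∣≡1+∣p-x∣ : ∀ {n} {p : Subset n} {x} → x ∈ p → ∣ p ∣ ≡ suc ∣ p - x ∣
x∈p⇒∣p∣≡1+∣p-x∣ {p = inside  ∷ p} here        = cong suc (cong ∣_∣ (sym (p─⊥≡p p)))
x∈p⇒∣p∣≡1+∣p-x∣ {p = inside  ∷ p} (there x∈p) = cong suc (x∈p⇒∣p∣≡1+∣p-x∣ x∈p)
x∈p⇒∣p∣≡1+∣p-x∣ {p = outside ∷ p} (there x∈p) = x∈p⇒∣p∣≡1+∣p-x∣ x∈p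

x∉p-x : ∀ {n} {p : Subset n} {x} → x ∉ p - x
x∉p-x {p = _ ∷ p} {Fin.suc x} (there x∈p-x) = x∉p-x {p = p} x∈p-x

x∉p⇒p∪⁅x⁆-x≡p : ∀ {n} {p : Subset n} {x} → x ∉ p → (p ∪ ⁅ x ⁆) - x ≡ p
x∉p⇒p∪⁅x⁆-x≡p {p = inside  ∷ p} {Fin.zero}  x∉p = contradiction here x∉p
x∉p⇒p∪⁅x⁆-x≡p {p = outside ∷ p} {Fin.zero}  _   =
  cong (outside ∷_) (trans (p─⊥≡p (p ∪ ⊥)) (∪-identityʳ p))
x∉p⇒p∪⁅x⁆-x≡p {p = inside  ∷ p} {Fin.suc x} x∉p = cong (inside ∷_) (x∉p⇒p∪⁅x⁆-x≡p (x∉p ∘ there))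
x∉p⇒p∪⁅x⁆-x≡p {p = outside ∷ p} {Fin.suc x} x∉p = cong (outside ∷_) (x∉p⇒p∪⁅x⁆-x≡p (x∉p ∘ there))

x∉p⇒∣p∪⁅x⁆∣≡1+∣p∣ : ∀ {n} {p : Subset n} {x} → x ∉ p → ∣ p ∪ ⁅ x ⁆ ∣ ≡ suc ∣ p ∣
x∉p⇒∣p∪⁅x⁆∣≡1+∣p∣ {p = p} {x} x∉p = trans
  (x∈p⇒∣p∣≡1+∣p-x∣ (x∈p∪q⁺ {p = p} (inj₂ (x∈⁅x⁆ x))))
  (cong (suc ∘ ∣_∣) (x∉p⇒p∪⁅x⁆-x≡p x∉p))

prefix-suc : ∀ {n} k (x : Fin n) → Prefix k x → Prefix (suc k) x
prefix-suc k x = ℕ.m<n⇒m<1+n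

prefix-suc-≢ : ∀ {n} {k} {x : Fin n} → Prefix (suc k) x → toℕ x ≢ k → Prefix k x
prefix-suc-≢ x<k+1 x≢k = ℕ.≤∧≢⇒< (ℕ.m<1+n⇒m≤n x<k+1) x≢k

module _ {n : ℕ} {G : Graph n} where

  walk-mono : ∀ {P Q : Fin n → Set} → (∀ x → P x → Q x) →
              ∀ {u v xs} → WalkIn G P u v xs → WalkIn G Q u v xs
  walk-mono P⊆Q (single p)   = single (P⊆Q _ p)
  walk-mono P⊆Q (step p e w) = step (P⊆Q _ p) e (walk-mono P⊆Q w)

  walk-++ : ∀ {P u w v xs ys} → WalkIn G P u w xs → WalkIn G P w v ys → ∃ λ zs → WalkIn G P u v zs
  walk-++ (single _)   w′ = _ , w′
  walk-++ (step p e w) w′ with walk-++ w w′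
  ... | _ , w″ = _ , step p e w″

  reaches-refl : ∀ {P u} → P u → Reaches G P u u
  reaches-refl p = _ , single p , [] ∷ []

  reaches-mono : ∀ {P Q : Fin n → Set} → (∀ x → P x → Q x) → ∀ {u v} → Reaches G P u v → Reaches G Q u v
  reaches-mono P⊆Q (xs , w , unique) = xs , walk-mono P⊆Q w , unique

  antichain-⊆ : ∀ {P A B} → B ⊆ A → IsAntichain G P A → IsAntichain G P B
  antichain-⊆ B⊆A (A⊆P , noReach) =
    (λ u → A⊆P u ∘ B⊆A) , (λ u v u∈B v∈B → noReach u v (B⊆A u∈B) (B⊆A v∈B))

  antichain-shrink : ∀ {P Q : Fin n → Set} {A} → (∀ x → P x → Q x) →
                     IsAntichain G Q A → (∀ u → u ∈ A → P u) → IsAntichain G P A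
  antichain-shrink P⊆Q (_ , noReach) A⊆P =
    A⊆P , (λ u v u∈A v∈A u≢v → noReach u v u∈A v∈A u≢v ∘ reaches-mono P⊆Q)

  dominates-mono : ∀ {P Q : Fin n → Set} {A B} → (∀ x → P x → Q x) → Dominates G P B A → Dominates G Q B A
  dominates-mono P⊆Q (∣A∣≡∣B∣ , A↝B) = ∣A∣≡∣B∣ , λ b b∈B → lift (A↝B b b∈B)
    where
    lift : ∀ {b} → SetReaches G _ _ b → SetReaches G _ _ b
    lift (a , a∈A , a↝b) = a , a∈A , reaches-mono P⊆Q a↝b

  support⊆prefix : ∀ {k v} → InSupport G k v → Prefix k v
  support⊆prefix (A , ((A⊆P , _) , _) , v∈A) = A⊆P _ v∈A

module _ {n : ℕ} {G : Graph n} (top : IsTopOrder G) where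

  walk⇒≤ : ∀ {P u v xs} → WalkIn G P u v xs → u ≤ v
  walk⇒≤ (single _)   = ℕ.≤-refl
  walk⇒≤ (step _ e w) = ℕ.<⇒≤ (ℕ.<-≤-trans (top _ _ e) (walk⇒≤ w))

  walk-from-below : ∀ {P u v xs} → WalkIn G P u v xs → ListAll.All (u ≤_) xs
  walk-from-below (single _)   = ℕ.≤-refl ∷ []
  walk-from-below (step _ e w) =
    ℕ.≤-refl ∷ ListAll.map (ℕ.<⇒≤ ∘ ℕ.<-≤-trans (top _ _ e)) (walk-from-below w)

  walk-unique : ∀ {P u v xs} → WalkIn G P u v xs → Unique xs
  walk-unique (single _)   = [] ∷ []
  walk-unique (step _ e w) =
    ListAll.map (λ w≤x u≡x → ℕ.<⇒≢ (ℕ.<-≤-trans (top _ _ e) w≤x) (cong toℕ u≡x)) (walk-from-below w)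
    ∷ walk-unique w

  walk-prefix : ∀ {P u v xs} k → Prefix k v → WalkIn G P u v xs → WalkIn G (Prefix k) u v xs
  walk-prefix k v<k (single _)   = single v<k
  walk-prefix k v<k (step p e w) = step (ℕ.≤-<-trans (walk⇒≤ (step p e w)) v<k) e (walk-prefix k v<k w)

  reaches⇒≤ : ∀ {P u v} → Reaches G P u v → u ≤ v
  reaches⇒≤ (_ , w , _) = walk⇒≤ w

  reaches-trans : ∀ {P u w v} → Reaches G P u w → Reaches G P w v → Reaches G P u v
  reaches-trans (_ , w , _) (_ , w′ , _) with walk-++ w w′
  ... | zs , w″ = zs , w″ , walk-unique w″

  reaches-prefix : ∀ {P u v} k → Prefix k v → Reaches G P u v → Reaches G (Prefix k) u v
  reaches-prefix k v<k (xs , w , unique) = xs , walk-prefix k v<k w , unique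

  antichain-lift : ∀ {k B} → IsAntichain G (Prefix k) B → IsAntichain G (Prefix (suc k)) B
  antichain-lift {k} (B⊆P , noReach) =
    (λ u → prefix-suc k u ∘ B⊆P u) ,
    (λ u v u∈B v∈B u≢v → noReach u v u∈B v∈B u≢v ∘ reaches-prefix k (B⊆P v v∈B))

  antichain-∪-last : ∀ {k B v} → IsAntichain G (Prefix k) B → toℕ v ≡ k →
                     (∀ u → u ∈ B → ¬ Reaches G (Prefix (suc k)) u v) →
                     IsAntichain G (Prefix (suc k)) (B ∪ ⁅ v ⁆)
  antichain-∪-last {k} {B} {v} (B⊆P , noReach) v≡k u↛v = members , noReach′
    where
    split : ∀ {u} → u ∈ B ∪ ⁅ v ⁆ → u ∈ B ⊎ u ≡ v
    split u∈ with x∈p∪q⁻ B ⁅ v ⁆ u∈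
    ... | inj₁ u∈B = inj₁ u∈B
    ... | inj₂ u∈v = inj₂ (x∈⁅y⁆⇒x≡y v u∈v)

    members : ∀ u → u ∈ B ∪ ⁅ v ⁆ → Prefix (suc k) u
    members u u∈ with split u∈
    ... | inj₁ u∈B = prefix-suc k u (B⊆P u u∈B)
    ... | inj₂ refl = subst (_<ℕ suc k) (sym v≡k) (ℕ.n<1+n k)

    noReach′ : ∀ u w → u ∈ B ∪ ⁅ v ⁆ → w ∈ B ∪ ⁅ v ⁆ → u ≢ w → ¬ Reaches G (Prefix (suc k)) u w
    noReach′ u w u∈ w∈ u≢w u↝w with split u∈ | split w∈
    ... | inj₁ u∈B | inj₁ w∈B = noReach u w u∈B w∈B u≢w (reaches-prefix k (B⊆P w w∈B) u↝w)
    ... | inj₁ u∈B | inj₂ refl = u↛v u u∈B u↝w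
    ... | inj₂ refl | inj₁ w∈B =
      ℕ.<-irrefl refl (ℕ.<-≤-trans (subst (toℕ w <ℕ_) (sym v≡k) (B⊆P w w∈B)) (reaches⇒≤ u↝w))
    ... | inj₂ refl | inj₂ refl = u≢w refl

  frontier-lower : ∀ {k A} → IsFrontier G (Prefix (suc k)) A → (∀ u → u ∈ A → Prefix k u) →
                   IsFrontier G (Prefix k) A
  frontier-lower {k} (antiA , maxA) A⊆P =
    antichain-shrink (prefix-suc k) antiA A⊆P ,
    λ B antiB B≢A B≻A → maxA B (antichain-lift antiB) B≢A (dominates-mono (prefix-suc k) B≻A)

  frontier-remove-last : ∀ {k A v} → IsFrontier G (Prefix (suc k)) A → v ∈ A → toℕ v ≡ k →
                         IsFrontier G (Prefix k) (A - v)
  frontier-remove-last {k} {A} {v} (antiA@(A⊆P , noReachA) , maxA) v∈A v≡k = antiA′ , maxA′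
    where
    A-v⊆A : A - v ⊆ A
    A-v⊆A = p─q⊆p A ⁅ v ⁆

    A-v∌v : ∀ {u} → u ∈ A - v → u ≢ v
    A-v∌v u∈ refl = x∉p-x u∈

    antiA′ : IsAntichain G (Prefix k) (A - v)
    antiA′ = antichain-shrink (prefix-suc k) (antichain-⊆ A-v⊆A antiA) λ u u∈ →
      prefix-suc-≢ (A⊆P u (A-v⊆A u∈)) (λ u≡k → A-v∌v u∈ (toℕ-injective (trans u≡k (sym v≡k))))

    maxA′ : ∀ B → IsAntichain G (Prefix k) B → B ≢ A - v → ¬ Dominates G (Prefix k) B (A - v)
    maxA′ B antiB@(B⊆P , _) B≢A-v (∣A-v∣≡∣B∣ , A-v↝B) = maxA (B ∪ ⁅ v ⁆) antiB⁺ B⁺≢A (∣A∣≡∣B⁺∣ , A↝B⁺)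
      where
      v∉B : v ∉ B
      v∉B v∈B = ℕ.<-irrefl v≡k (B⊆P v v∈B)

      B↛v : ∀ u → u ∈ B → ¬ Reaches G (Prefix (suc k)) u v
      B↛v u u∈B u↝v with A-v↝B u u∈B
      ... | a , a∈ , a↝u =
        noReachA a v (A-v⊆A a∈) v∈A (A-v∌v a∈) (reaches-trans (reaches-mono (prefix-suc k) a↝u) u↝v)

      antiB⁺ : IsAntichain G (Prefix (suc k)) (B ∪ ⁅ v ⁆)
      antiB⁺ = antichain-∪-last antiB v≡k B↛v

      B⁺≢A : B ∪ ⁅ v ⁆ ≢ A
      B⁺≢A B⁺≡A = B≢A-v (trans (sym (x∉p⇒p∪⁅x⁆-x≡p v∉B)) (cong (_- v) B⁺≡A))

      ∣A∣≡∣B⁺∣ : ∣ A ∣ ≡ ∣ B ∪ ⁅ v ⁆ ∣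
      ∣A∣≡∣B⁺∣ = begin
        ∣ A ∣             ≡⟨ x∈p⇒∣p∣≡1+∣p-x∣ v∈A ⟩
        suc ∣ A - v ∣     ≡⟨ cong suc ∣A-v∣≡∣B∣ ⟩
        suc ∣ B ∣         ≡⟨ sym (x∉p⇒∣p∪⁅x⁆∣≡1+∣p∣ v∉B) ⟩
        ∣ B ∪ ⁅ v ⁆ ∣     ∎
        where open ≡-Reasoning

      A↝B⁺ : ∀ b → b ∈ B ∪ ⁅ v ⁆ → SetReaches G (Prefix (suc k)) A b
      A↝B⁺ b b∈ with x∈p∪q⁻ B ⁅ v ⁆ b∈
      ... | inj₁ b∈B with A-v↝B b b∈B
      ...   | a , a∈ , a↝b = a , A-v⊆A a∈ , reaches-mono (prefix-suc k) a↝b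
      A↝B⁺ b b∈ | inj₂ b∈v with x∈⁅y⁆⇒x≡y v b∈v
      ...   | refl = v , v∈A , reaches-refl (A⊆P v v∈A)

  support-suc⇒support : ∀ {k s} → toℕ s <ℕ k → InSupport G (suc k) s → InSupport G k s
  support-suc⇒support {k} {s} s<k (A , frontA , s∈A) with any? (λ v → v ∈? A ×-dec (toℕ v ℕ.≟ k))
  ... | yes (v , v∈A , v≡k) =
    A - v , frontier-remove-last frontA v∈A v≡k , x∈p∧x≢y⇒x∈p-y s∈A λ { refl → ℕ.<-irrefl v≡k s<k }
  ... | no ∄v = A , frontier-lower frontA A⊆Pₖ , s∈A
    where
    A⊆Pₖ : ∀ u → u ∈ A → Prefix k u
    A⊆Pₖ u u∈A = prefix-suc-≢ (support⊆prefix (A , frontA , u∈A)) λ u≡k → ∄v (u , u∈A , u≡k)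

  support-descend : ∀ {s t u} → toℕ s <ℕ t → t ≤′ u → InSupport G u s → InSupport G t s
  support-descend s<t ≤′-refl          s∈Su = s∈Su
  support-descend s<t (≤′-step t≤′u) s∈Su =
    support-descend s<t t≤′u (support-suc⇒support (ℕ.<-≤-trans s<t (ℕ.≤′⇒≤ t≤′u)) s∈Su)

theorem2 : (n : ℕ) (G : Graph n) → IsTopOrder G → (i : Fin n) →
    (s t : Fin n) →
    (InSupport G (toℕ i) s ⊎ s ≡ i) →
    (InSupport G (toℕ i) t ⊎ t ≡ i) →
    (Reaches G All s t ⇔ (s ≡ t ⊎ (s < t × InSupport G (toℕ t) s × Reaches G All s t)))
    × (s < t → InSupport G (toℕ t) s)
theorem2 n G top i s t s∈S⁺ t∈S⁺ = mk⇔ forward backward , s<t⇒s∈Sₜ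
  where
  t≤i : toℕ t ≤ℕ toℕ i
  t≤i = bounded t∈S⁺
    where
    bounded : InSupport G (toℕ i) t ⊎ t ≡ i → toℕ t ≤ℕ toℕ i
    bounded (inj₁ t∈Sᵢ) = ℕ.<⇒≤ (support⊆prefix t∈Sᵢ)
    bounded (inj₂ refl) = ℕ.≤-refl

  s<t⇒s∈Sₜ : s < t → InSupport G (toℕ t) s
  s<t⇒s∈Sₜ = descend s∈S⁺
    where
    descend : InSupport G (toℕ i) s ⊎ s ≡ i → s < t → InSupport G (toℕ t) s
    descend (inj₁ s∈Sᵢ) s<t = support-descend top s<t (ℕ.≤⇒≤′ t≤i) s∈Sᵢ
    descend (inj₂ refl) s<t = contradiction (ℕ.<-≤-trans s<t t≤i) (ℕ.<-irrefl refl)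

  forward : Reaches G All s t → s ≡ t ⊎ (s < t × InSupport G (toℕ t) s × Reaches G All s t)
  forward s↝t with s ≟ t
  ... | yes s≡t = inj₁ s≡t
  ... | no s≢t  = let s<t = ℕ.≤∧≢⇒< (reaches⇒≤ top s↝t) (s≢t ∘ toℕ-injective) in
                  inj₂ (s<t , s<t⇒s∈Sₜ s<t , s↝t)

  backward : s ≡ t ⊎ (s < t × InSupport G (toℕ t) s × Reaches G All s t) → Reaches G All s t
  backward (inj₁ refl)          = reaches-refl tt
  backward (inj₂ (_ , _ , s↝t)) = s↝t
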